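{- Let $p$ be an odd prime and $k$ a nonnegative integer. There is no $2$-near perfect number $n = 2^k p^2$ whose omitted divisors are $d_1 = 2^a$ for some $0 \le a \le k$ and $d_2 = p^m$ for some $m \in \{1, 2\}$.
   Context: $\sigma(n)$ denotes the sum of the positive divisors of $n$. A positive integer $n$ is called $2$-near perfect if $\sigma(n) = 2n + d_1 + d_2$ for some two distinct positive divisors $d_1, d_2$ of $n$; these $d_1, d_2$ are called the omitted divisors. -}

module Defs where

open import Data.Nat using (ℕ; suc; _+_; _*_)
open import Data.Nat.Divisibility using (_∣_; _∣?_)
open import Data.List using (List; filterᵇ)
open import Data.Nat.ListAction using (sum)
open import Data.List using (upTo)
open import Data.Product using (_×_)
open import Relation.Nullary using (¬_)
open import Relation.Nullary.Decidable using (⌊_⌋)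
open import Relation.Binary.PropositionalEquality using (_≡_)

-- divisors of n: the d ∈ {1, …, n} with d ∣ n  (empty for n = 0)
divisors : ℕ → List ℕ
divisors n = filterᵇ (λ d → ⌊ d ∣? n ⌋) (Data.List.map suc (upTo n))

σ : ℕ → ℕ
σ n = sum (divisors n)

TwoNearPerfectWith : ℕ → ℕ → ℕ → Set
TwoNearPerfectWith n d₁ d₂ =
  (d₁ ∣ n) × (d₂ ∣ n) × ¬ (d₁ ≡ d₂) × ¬ (d₁ ≡ 0) × ¬ (d₂ ≡ 0) × (σ n ≡ 2 * n + d₁ + d₂)

{-# OPTIONS --safe #-}
-- Summing the divisors layer by layer over the power of 2 gives
-- σ(2^k p²) = (2^(k+1) − 1)(1 + p + p²), so the near-perfect equation reduces to
-- 2^a + p^m + 1 + p + p² = 2^(k+1)(1 + p).  For m = 1 this says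
-- 2^a = (1 + p)(2^(k+1) − 1 − p), which is either non-positive or larger than 2^k.
-- For m = 2, the two sides are compared according as 2^k < p or 2^k > p;
-- 2^k = p is excluded as p is an odd prime.
module Submission where

open import Defs
open import Data.Empty using (⊥-elim)
open import Data.List using (List; []; _∷_; _++_; map; upTo)
open import Data.List.Membership.Propositional using (_∈_)
open import Data.List.Membership.Propositional.Properties
  using (∈-++⁻; ∈-++⁺ˡ; ∈-++⁺ʳ; ∈-map⁻; ∈-map⁺; ∈-filter⁻; ∈-filter⁺; ∈-upTo⁺)
open import Data.List.Membership.Propositional.Properties.WithK using (unique∧set⇒bag)
open import Data.List.Relation.Binary.BagAndSetEquality using (∼bag⇒↭)
open import Data.List.Relation.Unary.AllPairs using ([]; _∷_)
open import Data.List.Relation.Unary.All using ([]; _∷_)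
open import Data.List.Relation.Unary.Any using (here; there)
open import Data.List.Relation.Unary.Unique.Propositional using (Unique)
import Data.List.Relation.Unary.Unique.Propositional.Properties as Unique
open import Data.Nat
open import Data.Nat.Coprimality using (Coprime; coprime-divisor)
open import Data.Nat.Divisibility
open import Data.Nat.ListAction using (sum)
open import Data.Nat.ListAction.Properties using (sum-++; sum-↭)
open import Data.Nat.Primality
open import Data.Nat.Properties
open import Data.Nat.Tactic.RingSolver using (solve-∀)
open import Data.Product using (_×_; _,_; proj₂)
open import Data.Sum using (_⊎_; inj₁; inj₂)
open import Function using (_∘_)
open import Function.Bundles using (_⇔_; mk⇔)
open import Relation.Binary.PropositionalEquality
open import Relation.Binary.Definitions using (tri<; tri≈; tri>)
open import Relation.Nullary using (¬_; yes; no)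
open import Relation.Nullary.Decidable using (⌊_⌋; toWitness; fromWitness)
open import Relation.Nullary.Decidable.Core using (T?)

sum-map-*ʳ : ∀ m xs → sum (map (_* m) xs) ≡ sum xs * m
sum-map-*ʳ m [] = refl
sum-map-*ʳ m (x ∷ xs) = trans (cong (x * m +_) (sum-map-*ʳ m xs)) (sym (*-distribʳ-+ m x (sum xs)))

unique∧set⇒sum≡ : {xs ys : List ℕ} → Unique xs → Unique ys → (∀ {x} → x ∈ xs ⇔ x ∈ ys) →
  sum xs ≡ sum ys
unique∧set⇒sum≡ xs! ys! xs≈ys = sum-↭ (∼bag⇒↭ (unique∧set⇒bag xs! ys! xs≈ys))

¬∣⇒coprime : ∀ {p d} → Prime p → ¬ p ∣ d → Coprime d p
¬∣⇒coprime pr p∤d (i∣d , i∣p) with prime⇒irreducible pr i∣p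
... | inj₁ i≡1 = i≡1
... | inj₂ refl = ⊥-elim (p∤d i∣d)

odd⇒≢0 : ∀ {n} → ¬ 2 ∣ n → n ≢ 0
odd⇒≢0 2∤n refl = 2∤n (2 ∣0)

odd*odd : ∀ {m n} → ¬ 2 ∣ m → ¬ 2 ∣ n → ¬ 2 ∣ m * n
odd*odd {m} {n} 2∤m 2∤n 2∣mn with euclidsLemma m n prime[2] 2∣mn
... | inj₁ 2∣m = 2∤m 2∣m
... | inj₂ 2∣n = 2∤n 2∣n

divisors-unique : ∀ n → Unique (divisors n)
divisors-unique n = Unique.filter⁺ _ (Unique.map⁺ suc-injective (Unique.upTo⁺ n))

∈-divisors⁻ : ∀ {n d} → d ∈ divisors n → d ∣ n
∈-divisors⁻ {n} d∈ = toWitness (proj₂ (∈-filter⁻ (λ d → T? ⌊ d ∣? n ⌋) {xs = map suc (upTo n)} d∈))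

∈-divisors⁺ : ∀ {n d} → n ≢ 0 → d ∣ n → d ∈ divisors n
∈-divisors⁺ {n} {zero} n≢0 0∣n = ⊥-elim (n≢0 (0∣⇒≡0 0∣n))
∈-divisors⁺ {n} {suc _} n≢0 d∣n =
  ∈-filter⁺ (λ d → T? ⌊ d ∣? n ⌋) (∈-map⁺ suc (∈-upTo⁺ (∣⇒≤ {{≢-nonZero n≢0}} d∣n))) (fromWitness d∣n)

odd∣2^k*n⇒∣n : ∀ k {d n} → ¬ 2 ∣ d → d ∣ 2 ^ k * n → d ∣ n
odd∣2^k*n⇒∣n zero {d} {n} _ d∣n = subst (d ∣_) (*-identityˡ n) d∣n
odd∣2^k*n⇒∣n (suc k) {d} {n} 2∤d d∣ = odd∣2^k*n⇒∣n k 2∤d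
  (coprime-divisor (¬∣⇒coprime prime[2] 2∤d) (subst (d ∣_) (*-assoc 2 (2 ^ k) n) d∣))

-- For odd q this is a rearrangement of divisors (2 ^ k * q), layered by the power of 2.
divisors₂ : ℕ → ℕ → List ℕ
divisors₂ zero    q = divisors q
divisors₂ (suc k) q = divisors q ++ map (_* 2) (divisors₂ k q)

2^[1+k]*n≡2^k*n*2 : ∀ k n → 2 ^ suc k * n ≡ 2 ^ k * n * 2
2^[1+k]*n≡2^k*n*2 k n = trans (*-assoc 2 (2 ^ k) n) (*-comm 2 (2 ^ k * n))

∈-divisors₂⁻ : ∀ k {q d} → d ∈ divisors₂ k q → d ∣ 2 ^ k * q
∈-divisors₂⁻ zero {q} d∈ = ∣-trans (∈-divisors⁻ d∈) (n∣m*n 1)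
∈-divisors₂⁻ (suc k) {q} d∈ with ∈-++⁻ (divisors q) d∈
... | inj₁ d∈divisors = ∣-trans (∈-divisors⁻ d∈divisors) (n∣m*n (2 ^ suc k))
... | inj₂ d∈doubled with ∈-map⁻ (_* 2) d∈doubled
...   | e , e∈ , refl = subst (e * 2 ∣_) (sym (2^[1+k]*n≡2^k*n*2 k q))
                              (*-monoˡ-∣ 2 (∈-divisors₂⁻ k e∈))

∈-divisors₂⁺ : ∀ k {q d} → ¬ 2 ∣ q → d ∣ 2 ^ k * q → d ∈ divisors₂ k q
∈-divisors₂⁺ zero {q} 2∤q d∣ = ∈-divisors⁺ (odd⇒≢0 2∤q) (subst (_ ∣_) (*-identityˡ q) d∣)
∈-divisors₂⁺ (suc k) {q} {d} 2∤q d∣ with 2 ∣? d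
... | yes (divides e refl) = ∈-++⁺ʳ (divisors q) (∈-map⁺ (_* 2) {e} (∈-divisors₂⁺ k 2∤q
        (*-cancelʳ-∣ 2 (subst (e * 2 ∣_) (2^[1+k]*n≡2^k*n*2 k q) d∣))))
... | no 2∤d = ∈-++⁺ˡ (∈-divisors⁺ (odd⇒≢0 2∤q) (odd∣2^k*n⇒∣n (suc k) 2∤d d∣))

divisors₂-unique : ∀ k {q} → ¬ 2 ∣ q → Unique (divisors₂ k q)
divisors₂-unique zero    {q} _   = divisors-unique q
divisors₂-unique (suc k) {q} 2∤q = Unique.++⁺ (divisors-unique q)
  (Unique.map⁺ (λ {x} {y} → *-cancelʳ-≡ x y 2) (divisors₂-unique k 2∤q)) odd-and-even
  where
  odd-and-even : ∀ {d} → ¬ (d ∈ divisors q × d ∈ map (_* 2) (divisors₂ k q))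
  odd-and-even (d∈divisors , d∈doubled) with ∈-map⁻ (_* 2) d∈doubled
  ... | e , _ , refl = 2∤q (∣-trans (n∣m*n e) (∈-divisors⁻ d∈divisors))

sum-divisors₂ : ∀ k q → sum (divisors₂ k q) + σ q ≡ 2 ^ suc k * σ q
sum-divisors₂ zero    q = cong (σ q +_) (sym (+-identityʳ (σ q)))
sum-divisors₂ (suc k) q = begin
  sum (divisors q ++ map (_* 2) D) + σ q   ≡⟨ cong (_+ σ q) (sum-++ (divisors q) (map (_* 2) D)) ⟩
  σ q + sum (map (_* 2) D) + σ q           ≡⟨ cong (λ s → σ q + s + σ q) (sum-map-*ʳ 2 D) ⟩
  σ q + sum D * 2 + σ q                    ≡⟨ regroup (σ q) (sum D) ⟩
  2 * (sum D + σ q)                        ≡⟨ cong (2 *_) (sum-divisors₂ k q) ⟩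
  2 * (2 ^ suc k * σ q)                    ≡⟨ *-assoc 2 (2 ^ suc k) (σ q) ⟨
  2 ^ suc (suc k) * σ q                    ∎
  where
  open ≡-Reasoning
  D = divisors₂ k q
  regroup : ∀ s t → s + t * 2 + s ≡ 2 * (t + s)
  regroup = solve-∀

σ[2^k*odd] : ∀ k {q} → ¬ 2 ∣ q → σ (2 ^ k * q) + σ q ≡ 2 ^ suc k * σ q
σ[2^k*odd] k {q} 2∤q = trans
  (cong (_+ σ q) (unique∧set⇒sum≡ (divisors-unique (2 ^ k * q)) (divisors₂-unique k 2∤q)
    (mk⇔ (∈-divisors₂⁺ k 2∤q ∘ ∈-divisors⁻) (∈-divisors⁺ 2^k*q≢0 ∘ ∈-divisors₂⁻ k))))
  (sum-divisors₂ k q)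
  where
  2^k*q≢0 : 2 ^ k * q ≢ 0
  2^k*q≢0 = ≢-nonZero⁻¹ _ {{m*n≢0 (2 ^ k) q {{m^n≢0 2 k}} {{≢-nonZero (odd⇒≢0 2∤q)}}}}

∣p*p⇒≡1⊎≡p⊎≡p*p : ∀ {p d} → Prime p → d ∣ p * p → d ≡ 1 ⊎ d ≡ p ⊎ d ≡ p * p
∣p*p⇒≡1⊎≡p⊎≡p*p {p} {d} pr d∣ with p ∣? d
... | yes (divides e refl)
  with prime⇒irreducible pr {e} (*-cancelʳ-∣ p {{prime⇒nonZero pr}} d∣)
...   | inj₁ refl = inj₂ (inj₁ (*-identityˡ p))
...   | inj₂ refl = inj₂ (inj₂ refl)
∣p*p⇒≡1⊎≡p⊎≡p*p {p} {d} pr d∣ | no p∤d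
  with prime⇒irreducible pr (coprime-divisor (¬∣⇒coprime pr p∤d) d∣)
...   | inj₁ d≡1 = inj₁ d≡1
...   | inj₂ d≡p = inj₂ (inj₁ d≡p)

σ[p*p] : ∀ {p} → Prime p → σ (p * p) ≡ 1 + p + p * p
σ[p*p] {p} pr = trans
  (unique∧set⇒sum≡ (divisors-unique (p * p)) distinct
    (mk⇔ (listed ∘ ∈-divisors⁻) (∈-divisors⁺ p*p≢0 ∘ listed⇒∣)))
  (cong (λ s → 1 + (p + s)) (+-identityʳ (p * p)))
  where
  instance _ = prime⇒nonZero pr
  1≢p : 1 ≢ p
  1≢p = nonTrivial⇒≢1 {{prime⇒nonTrivial pr}} ∘ sym
  distinct : Unique (1 ∷ p ∷ p * p ∷ [])
  distinct = (1≢p ∷ (1≢p ∘ sym ∘ m*n≡1⇒m≡1 p p ∘ sym) ∷ [])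
           ∷ ((1≢p ∘ *-cancelˡ-≡ 1 p p ∘ trans (*-identityʳ p)) ∷ [])
           ∷ [] ∷ []
  p*p≢0 : p * p ≢ 0
  p*p≢0 = ≢-nonZero⁻¹ _ {{m*n≢0 p p}}
  listed : ∀ {d} → d ∣ p * p → d ∈ 1 ∷ p ∷ p * p ∷ []
  listed d∣ with ∣p*p⇒≡1⊎≡p⊎≡p*p pr d∣
  ... | inj₁ refl = here refl
  ... | inj₂ (inj₁ refl) = there (here refl)
  ... | inj₂ (inj₂ refl) = there (there (here refl))
  listed⇒∣ : ∀ {d} → d ∈ 1 ∷ p ∷ p * p ∷ [] → d ∣ p * p
  listed⇒∣ (here refl) = 1∣ _
  listed⇒∣ (there (here refl)) = m∣m*n p
  listed⇒∣ (there (there (here refl))) = ∣-refl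

A+q*q≢X*q : ∀ {A q X} → 2 ≤ q → 1 ≤ A → 2 * A ≤ X → A + q * q ≢ X * q
A+q*q≢X*q {A} {q} {X} 2≤q 1≤A 2A≤X eq with X ≤? q
... | yes X≤q = <-irrefl refl (begin-strict
  X * q      ≤⟨ *-monoˡ-≤ q X≤q ⟩
  q * q      <⟨ m<n+m (q * q) 1≤A ⟩
  A + q * q  ≡⟨ eq ⟩
  X * q      ∎)
  where open ≤-Reasoning
... | no X≰q with m≤n⇒∃[o]m+o≡n 2≤q | m≤n⇒∃[o]m+o≡n (≰⇒> X≰q)
...   | r , refl | t , refl = m+1+n≰m X (begin
  X + suc (r + 3 * t + 2 * t * r)  ≡⟨ excess r t ⟩
  2 * ((1 + t) * (2 + r))          ≡⟨ cong (2 *_) A≡ ⟨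
  2 * A                            ≤⟨ 2A≤X ⟩
  X                                ∎)
  where
  open ≤-Reasoning
  A≡ : A ≡ (1 + t) * (2 + r)
  A≡ = +-cancelʳ-≡ ((2 + r) * (2 + r)) A _ (trans eq (expand r t))
    where
    expand : ∀ r t → (3 + r + t) * (2 + r) ≡ (1 + t) * (2 + r) + (2 + r) * (2 + r)
    expand = solve-∀
  excess : ∀ r t → 3 + r + t + suc (r + 3 * t + 2 * t * r) ≡ 2 * ((1 + t) * (2 + r))
  excess = solve-∀

A+p*p+[1+p+p*p]≢2*N*[1+p] : ∀ {A N p} → 1 ≤ p → A ≤ N → N ≢ p →
  A + p * p + (1 + p + p * p) ≢ 2 * N * (1 + p)
A+p*p+[1+p+p*p]≢2*N*[1+p] {A} {N} {p} 1≤p A≤N N≢p eq with <-cmp N p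
... | tri≈ _ N≡p _ = N≢p N≡p
... | tri< N<p _ _ with m≤n⇒∃[o]m+o≡n N<p
...   | t , refl = m≢1+m+n (2 * N * (1 + p)) (trans (sym eq) (excess A N t))
  where
  excess : ∀ A N t → A + (1 + N + t) * (1 + N + t) + (1 + (1 + N + t) + (1 + N + t) * (1 + N + t))
                   ≡ suc (2 * N * (1 + (1 + N + t)) + (A + 3 + N + 5 * t + 2 * N * t + 2 * t * t))
  excess = solve-∀
A+p*p+[1+p+p*p]≢2*N*[1+p] {A} {N} {p} 1≤p A≤N N≢p eq | tri> _ _ p<N
  with m≤n⇒∃[o]m+o≡n 1≤p | m≤n⇒∃[o]m+o≡n p<N
...   | p′ , refl | t , refl = m+1+n≰m (N + p * p + c) (begin
  N + p * p + c + suc (1 + 2 * p′ + 3 * t + 2 * t * p′)  ≡⟨ excess p′ t ⟩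
  2 * N * (1 + p)                                       ≡⟨ eq ⟨
  A + p * p + c                                         ≤⟨ +-monoˡ-≤ c (+-monoˡ-≤ (p * p) A≤N) ⟩
  N + p * p + c                                         ∎)
  where
  open ≤-Reasoning
  c = 1 + p + p * p
  excess : ∀ p′ t → let p = 1 + p′; N = 1 + p + t; c = 1 + p + p * p in
           N + p * p + c + suc (1 + 2 * p′ + 3 * t + 2 * t * p′) ≡ 2 * N * (1 + p)
  excess = solve-∀

2^k≢odd-prime : ∀ k {p} → Prime p → ¬ 2 ∣ p → 2 ^ k ≢ p
2^k≢odd-prime zero    pr _   1≡p = nonTrivial⇒≢1 {{prime⇒nonTrivial pr}} (sym 1≡p)
2^k≢odd-prime (suc k) _  2∤p refl = 2∤p (m∣m*n (2 ^ k))

n^2≡n*n : ∀ n → n ^ 2 ≡ n * n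
n^2≡n*n n = cong (n *_) (*-identityʳ n)

twoNearPerfect[2^k*p^2]⇒ : ∀ k {p A B} → Prime p → ¬ 2 ∣ p →
  σ (2 ^ k * p ^ 2) ≡ 2 * (2 ^ k * p ^ 2) + A + B →
  A + B + (1 + p + p * p) ≡ 2 * 2 ^ k * (1 + p)
twoNearPerfect[2^k*p^2]⇒ k {p} {A} {B} pr 2∤p σ≡ = +-cancelˡ-≡ (2 * (N * (p * p))) _ _ (begin
  2 * (N * (p * p)) + (A + B + c)        ≡⟨ regroup (2 * (N * (p * p))) A B c ⟩
  2 * (N * (p * p)) + A + B + c          ≡⟨ cong (_+ c) σ≡′ ⟨
  σ (N * (p * p)) + c                    ≡⟨ cong (σ (N * (p * p)) +_) (σ[p*p] pr) ⟨
  σ (N * (p * p)) + σ (p * p)            ≡⟨ σ[2^k*odd] k (odd*odd 2∤p 2∤p) ⟩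
  2 ^ suc k * σ (p * p)                  ≡⟨ cong (2 ^ suc k *_) (σ[p*p] pr) ⟩
  2 * N * c                              ≡⟨ split N p ⟩
  2 * (N * (p * p)) + 2 * N * (1 + p)    ∎)
  where
  open ≡-Reasoning
  N = 2 ^ k
  c = 1 + p + p * p
  σ≡′ : σ (N * (p * p)) ≡ 2 * (N * (p * p)) + A + B
  σ≡′ = subst (λ s → σ (N * s) ≡ 2 * (N * s) + A + B) (n^2≡n*n p) σ≡
  regroup : ∀ x A B c → x + (A + B + c) ≡ x + A + B + c
  regroup = solve-∀
  split : ∀ N p → 2 * N * (1 + p + p * p) ≡ 2 * (N * (p * p)) + 2 * N * (1 + p)
  split = solve-∀

proposition9 : (p k a m : ℕ) → Prime p → ¬ (2 ∣ p) → a ≤ k → (m ≡ 1 ⊎ m ≡ 2) →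
    ¬ TwoNearPerfectWith (2 ^ k * p ^ 2) (2 ^ a) (p ^ m)
proposition9 p k a _ pr 2∤p a≤k (inj₁ refl) (_ , _ , _ , _ , _ , σ≡) =
  A+q*q≢X*q (s≤s 1≤p) (m^n>0 2 a) (*-monoʳ-≤ 2 (^-monoʳ-≤ 2 a≤k))
    (trans (square (2 ^ a) p) (twoNearPerfect[2^k*p^2]⇒ k pr 2∤p σ≡))
  where
  1≤p : 1 ≤ p
  1≤p = >-nonZero⁻¹ p {{prime⇒nonZero pr}}
  square : ∀ A p → A + (1 + p) * (1 + p) ≡ A + p * 1 + (1 + p + p * p)
  square = solve-∀
proposition9 p k a _ pr 2∤p a≤k (inj₂ refl) (_ , _ , _ , _ , _ , σ≡) =
  A+p*p+[1+p+p*p]≢2*N*[1+p] (>-nonZero⁻¹ p {{prime⇒nonZero pr}}) (^-monoʳ-≤ 2 a≤k)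
    (2^k≢odd-prime k pr 2∤p)
    (subst (λ s → 2 ^ a + s + (1 + p + p * p) ≡ 2 * 2 ^ k * (1 + p))
      (n^2≡n*n p) (twoNearPerfect[2^k*p^2]⇒ k pr 2∤p σ≡))
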